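{- Let $m\ge1$ and let $y_1,\dots,y_m$ be distinct integers less than $-1$, and let $D=\{1,y_1,\dots,y_m\}$. If $(T,s)$ is a signed tree that realizes $D$, then $diam(T)\ge 4$ if $m=1$, $diam(T)\ge 5$ if $m=2$, and $diam(T)\ge 6$ if $m>2$.
   Context: A signed tree is a pair $(T,s)$ with $T$ a finite tree and $s:E(T)\to\{+,-\}$. The signed degree $sdeg(v)$ of a vertex is the number of incident positive edges minus the number of incident negative edges. $(T,s)$ realizes $D$ if $D=\{sdeg(v):v\in V(T)\}$. -}

module Defs where

open import Data.Nat using (ℕ; zero; suc; _≤_)
open import Data.Fin using (Fin; zero; suc; inject₁; fromℕ)
open import Data.Integer using (ℤ; +_; -_; _+_)
open import Data.Maybe using (Maybe; just; nothing)
open import Data.List using (List; foldr; map; allFin)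
open import Data.Product using (Σ; ∃; _×_; _,_)
open import Relation.Binary.PropositionalEquality using (_≡_)
open import Relation.Nullary using (¬_)
open import Function.Definitions using (Injective)

data Sign : Set where
  pos neg : Sign

-- A finite signed simple graph on vertex set Fin n:
-- sgn u v = just σ  iff  {u,v} is an edge with sign σ;  nothing = no edge.
record SignedGraph : Set where
  field
    n      : ℕ
    sgn    : Fin n → Fin n → Maybe Sign
    symm   : ∀ u v → sgn u v ≡ sgn v u
    noLoop : ∀ v → sgn v v ≡ nothing

module _ (G : SignedGraph) where
  open SignedGraph G

  Edge : Fin n → Fin n → Set
  Edge u v = ∃ λ σ → sgn u v ≡ just σ

  data Walk : Fin n → Fin n → ℕ → Set where
    here : ∀ {v} → Walk v v 0
    step : ∀ {u w v k} → Edge u w → Walk w v k → Walk u v (suc k)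

  Connected : Set
  Connected = ∀ u v → ∃ λ k → Walk u v k

  record Cycle : Set where
    field
      k     : ℕ
      c     : Fin (suc (suc (suc k))) → Fin n
      inj   : Injective _≡_ _≡_ c
      steps : ∀ (i : Fin (suc (suc k))) → Edge (c (inject₁ i)) (c (suc i))
      close : Edge (c (fromℕ (suc (suc k)))) (c zero)

  Acyclic : Set
  Acyclic = ¬ Cycle

  IsTree : Set
  IsTree = (1 ≤ n) × Connected × Acyclic

  signVal : Maybe Sign → ℤ
  signVal nothing    = + 0
  signVal (just pos) = + 1
  signVal (just neg) = - (+ 1)

  sumℤ : List ℤ → ℤ
  sumℤ = foldr _+_ (+ 0)

  sdeg : Fin n → ℤ
  sdeg v = sumℤ (map (λ u → signVal (sgn v u)) (allFin n))

  DistGE : Fin n → Fin n → ℕ → Set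
  DistGE u v d = ∀ {k} → Walk u v k → d ≤ k

  DiamGE : ℕ → Set
  DiamGE d = ∃ λ u → ∃ λ v → DistGE u v d

  Realizes : (ℤ → Set) → Set
  Realizes D = (∀ v → D (sdeg v)) × (∀ x → D x → ∃ λ v → sdeg v ≡ x)

{-# OPTIONS --safe #-}
-- A vertex of signed degree at most -2 has two neighbours across negative edges,
-- and neither is a leaf, since a leaf hanging on a negative edge has signed
-- degree -1, which is not in D. So a geodesic between two such vertices a, b can
-- be prolonged by two edges at each end without backtracking. In a tree a
-- non-backtracking walk is a geodesic (its vertices are distinct, or it would
-- close a cycle), so diam T ≥ d(a,b) + 4. Finally d(a,b) ≥ 1 when a ≠ b, and
-- among three such vertices two are non-adjacent (a tree has no triangle), so
-- then d(a,b) ≥ 2.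
module Submission where

open import Defs
open import Data.Nat using (ℕ; zero; suc; _+_; _≤_; z≤n; s≤s) renaming (_<_ to _<ℕ_)
open import Data.Nat.Properties using (≤-trans; <⇒≤; m≤n⇒m≤1+n)
open import Data.Fin using (Fin; zero; suc; inject₁; fromℕ; _≟_)
open import Data.Fin.Properties using (suc-injective)
open import Data.Integer using (ℤ; +_; -_; _<_; -[1+_])
import Data.Integer as ℤ
import Data.Integer.Properties as ℤ
open import Data.Maybe using (Maybe; just; nothing)
open import Data.List using (List; []; _∷_; _++_; [_]; length; lookup; tabulate)
open import Data.List.Properties using (map-tabulate)
open import Data.List.Relation.Unary.All as All using ([]; _∷_)
open import Data.List.Relation.Unary.All.Properties using (¬Any⇒All¬; ++⁻ˡ; ++⁻ʳ)
open import Data.List.Relation.Unary.Linked as Linked using (Linked; [-]; _∷_)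
open import Data.List.Relation.Unary.Unique.Propositional using (Unique; []; _∷_)
open import Data.List.Relation.Unary.Unique.Propositional.Properties using (Unique[x∷xs]⇒x∉xs)
open import Data.List.Membership.Propositional using (_∈_)
open import Data.List.Membership.Propositional.Properties using (∈-lookup; ∈-∃++)
open import Data.List.Relation.Unary.Any using (here; there)
open import Data.Product using (∃; ∃₂; _×_; _,_; proj₁; proj₂)
import Data.Product as Product
open import Data.Sum using (_⊎_; inj₁; inj₂; map₂)
open import Data.Empty using (⊥; ⊥-elim)
open import Data.Unit.Polymorphic using (⊤; tt)
open import Function using (id; _∘_; case_of_)
open import Function.Definitions using (Injective)
open import Relation.Binary using (Rel)
open import Relation.Binary.PropositionalEquality
  using (_≡_; _≢_; refl; sym; trans; cong; subst; ≢-sym)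
open import Relation.Nullary using (¬_; Dec; yes; no)

module _ {a} {A : Set a} where

  NonBacktracking : List A → Set a
  NonBacktracking (x ∷ y ∷ z ∷ xs) = x ≢ z × NonBacktracking (y ∷ z ∷ xs)
  NonBacktracking _                = ⊤

  NonBacktracking-tail : ∀ {x} xs → NonBacktracking (x ∷ xs) → NonBacktracking xs
  NonBacktracking-tail []           _        = tt
  NonBacktracking-tail (_ ∷ [])     _        = tt
  NonBacktracking-tail (_ ∷ _ ∷ _) (_ , nb) = nb

  Unique-prefix : ∀ (ys : List A) {x zs} → Unique (ys ++ x ∷ zs) → Unique (x ∷ ys)
  Unique-prefix []       _                = [] ∷ []
  Unique-prefix (y ∷ ys) (y∉ ∷ ys-unique) with Unique-prefix ys ys-unique
  ... | x∉ys ∷ ys-unique′ = (x≢y ∷ x∉ys) ∷ ++⁻ˡ ys y∉ ∷ ys-unique′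
    where x≢y = ≢-sym (All.head (++⁻ʳ ys y∉))

  Unique⇒lookup-injective : ∀ {xs : List A} → Unique xs → Injective _≡_ _≡_ (lookup xs)
  Unique⇒lookup-injective {_ ∷ _} _        {zero}  {zero}  _  = refl
  Unique⇒lookup-injective {_ ∷ _} (x∉ ∷ _) {zero}  {suc j} eq = ⊥-elim (All.lookup x∉ (∈-lookup j) eq)
  Unique⇒lookup-injective {_ ∷ _} (x∉ ∷ _) {suc i} {zero}  eq = ⊥-elim (All.lookup x∉ (∈-lookup i) (sym eq))
  Unique⇒lookup-injective {_ ∷ _} (_ ∷ u)  {suc i} {suc j} eq = cong suc (Unique⇒lookup-injective u eq)

  module _ {ℓ} {R : Rel A ℓ} where

    Linked-prefix : ∀ xs {y zs} → Linked R (xs ++ y ∷ zs) → Linked R (xs ++ [ y ])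
    Linked-prefix []            _        = [-]
    Linked-prefix (_ ∷ [])      (r ∷ _)  = r ∷ [-]
    Linked-prefix (_ ∷ x ∷ xs) (r ∷ rs) = r ∷ Linked-prefix (x ∷ xs) rs

    Linked-lookup : ∀ {x} xs {y} → Linked R (x ∷ xs ++ [ y ]) →
                    ∀ i → R (lookup (x ∷ xs) (inject₁ i)) (lookup (x ∷ xs) (suc i))
    Linked-lookup (_ ∷ _)  (r ∷ _)  zero    = r
    Linked-lookup (_ ∷ xs) (_ ∷ rs) (suc i) = Linked-lookup xs rs i

    Linked-lookup-last : ∀ {x} xs {y} → Linked R (x ∷ xs ++ [ y ]) →
                         R (lookup (x ∷ xs) (fromℕ (length xs))) y
    Linked-lookup-last []       (r ∷ _)  = r
    Linked-lookup-last (_ ∷ xs) (_ ∷ rs) = Linked-lookup-last xs rs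

injective⇒distinct : ∀ {a b} {A : Set a} {B : Set b} {f : A → B} → Injective _≡_ _≡_ f →
                     ∀ {x y} → x ≢ y → f x ≢ f y
injective⇒distinct injective x≢y = x≢y ∘ injective

avoiding : ∀ {n p} {P : Fin n → Set p} {i j} → i ≢ j → P i → P j → ∀ a → ∃ λ k → P k × k ≢ a
avoiding {i = i} i≢j pi pj a with i ≟ a
... | yes refl = _ , pj , i≢j ∘ sym
... | no i≢a   = i , pi , i≢a

module _ (G : SignedGraph) where
  open SignedGraph G
  open import Data.List.Membership.DecPropositional (_≟_ {n}) using (_∈?_)

  private variable
    a b c u v w : Fin n
    d k : ℕ

  Edge-sym : Edge G u v → Edge G v u
  Edge-sym {u} {v} (σ , e) = σ , trans (symm v u) e

  Edge-irrefl : ¬ Edge G v v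
  Edge-irrefl {v} (σ , e) with trans (sym (noLoop v)) e
  ... | ()

  adjacent? : ∀ u v → Dec (Edge G u v)
  adjacent? u v with sgn u v
  ... | just σ  = yes (σ , refl)
  ... | nothing = no λ ()

  _▷_ : Walk G u v k → Edge G v w → Walk G u w (suc k)
  here     ▷ e = step e here
  step f W ▷ e = step f (W ▷ e)

  reverse : Walk G u v k → Walk G v u k
  reverse here       = here
  reverse (step e W) = reverse W ▷ Edge-sym e

  successors : Walk G u v k → List (Fin n)
  successors here                 = []
  successors (step {w = w} _ W) = w ∷ successors W

  vertices : Walk G u v k → List (Fin n)
  vertices {u} W = u ∷ successors W

  vertices-linked : (W : Walk G u v k) → Linked (Edge G) (vertices W)
  vertices-linked here       = [-]
  vertices-linked (step e W) = e ∷ vertices-linked W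

  end∈vertices : (W : Walk G u v k) → v ∈ vertices W
  end∈vertices here       = here refl
  end∈vertices (step _ W) = there (end∈vertices W)

  record Path (u v : Fin n) (k : ℕ) : Set where
    constructor path
    field
      walk            : Walk G u v k
      nonBacktracking : NonBacktracking (vertices walk)

  toPath : Walk G u v k → ∃ λ j → Path u v j
  toPath here = _ , path here tt
  toPath {u} (step e W) with toPath W
  ... | _ , path here _ = _ , path (step e here) tt
  ... | _ , path (step {w = t} f P) nb with t ≟ u
  ...   | yes refl = _ , path P (NonBacktracking-tail _ nb)
  ...   | no t≢u   = _ , path (step e (step f P)) (≢-sym t≢u , nb)

  -- Every path starting at v can be prolonged by two edges before v without backtracking.
  Extendable : Fin n → Set
  Extendable v = ∀ a → ∃₂ λ w x → Edge G x w × Edge G w v × x ≢ v × w ≢ a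

  extend : Extendable u → Path u v k → ∃ λ x → Path x v (2 + k)
  extend {u} ext (path here _) with ext u
  ... | w , x , xw , wu , x≢u , _ = x , path (step xw (step wu here)) (x≢u , tt)
  extend ext (path (step {w = t} e P) nb) with ext t
  ... | w , x , xw , wu , x≢u , w≢t = x , path (step xw (step wu (step e P))) (x≢u , w≢t , nb)

  cycle : ∀ {x y z} zs → Unique (x ∷ y ∷ z ∷ zs) → Linked (Edge G) (x ∷ y ∷ z ∷ zs ++ [ x ]) → Cycle G
  cycle {x} {y} {z} zs unique linked = record
    { k     = length zs
    ; c     = lookup (x ∷ y ∷ z ∷ zs)
    ; inj   = Unique⇒lookup-injective unique
    ; steps = Linked-lookup (y ∷ z ∷ zs) linked
    ; close = Linked-lookup-last (y ∷ z ∷ zs) linked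
    }

  distinct⇒DistGE-1 : u ≢ v → DistGE G u v 1
  distinct⇒DistGE-1 u≢v here       = ⊥-elim (u≢v refl)
  distinct⇒DistGE-1 _   (step _ _) = s≤s z≤n

  nonadjacent⇒DistGE-2 : u ≢ v → ¬ Edge G u v → DistGE G u v 2
  nonadjacent⇒DistGE-2 u≢v _   here                = ⊥-elim (u≢v refl)
  nonadjacent⇒DistGE-2 _   ¬uv (step e here)       = ⊥-elim (¬uv e)
  nonadjacent⇒DistGE-2 _   _   (step _ (step _ _)) = s≤s (s≤s z≤n)

  module _ (acyclic : Acyclic G) where

    nonBacktracking⇒Unique : ∀ xs → Linked (Edge G) xs → NonBacktracking xs → Unique xs
    nonBacktracking⇒Unique []       _      _  = []
    nonBacktracking⇒Unique (x ∷ xs) linked nb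
      with x ∈? xs | nonBacktracking⇒Unique xs (Linked.tail linked) (NonBacktracking-tail xs nb)
    ... | no x∉xs | xs-unique = ¬Any⇒All¬ xs x∉xs ∷ xs-unique
    ... | yes x∈xs | xs-unique with ys , zs , refl ← ∈-∃++ x∈xs =
      ⊥-elim (no-return ys (Unique-prefix ys xs-unique) (Linked-prefix (x ∷ ys) linked) nb)
      where
      no-return : ∀ ys {zs} → Unique (x ∷ ys) → Linked (Edge G) (x ∷ ys ++ [ x ]) →
                  NonBacktracking (x ∷ ys ++ x ∷ zs) → ⊥
      no-return []            _      (xx ∷ _) _        = Edge-irrefl xx
      no-return (_ ∷ [])      _      _        (x≢x , _) = x≢x refl
      no-return (_ ∷ _ ∷ ys) unique linked′   _        = acyclic (cycle ys unique linked′)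

    Path⇒DistGE : Path u v k → DistGE G u v k
    Path⇒DistGE (path here _) _ = z≤n
    Path⇒DistGE (path (step e P) nb) here =
      ⊥-elim (Unique[x∷xs]⇒x∉xs (nonBacktracking⇒Unique _ (vertices-linked (step e P)) nb) (end∈vertices P))
    Path⇒DistGE (path (step {w = t} e P) nb) (step {w = w} f W) with t ≟ w
    ... | yes refl = s≤s (Path⇒DistGE (path P (NonBacktracking-tail _ nb)) W)
    -- W leaves u towards w ≠ t, so stepping back from w onto P gives a longer path from w.
    ... | no t≢w   = m≤n⇒m≤1+n (<⇒≤ (Path⇒DistGE (path (step (Edge-sym f) (step e P)) (≢-sym t≢w , nb)) W))

    reversePath : Path u v k → ∃ λ j → k ≤ j × Path v u j
    reversePath P with toPath (reverse (Path.walk P))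
    ... | j , R = j , Path⇒DistGE P (reverse (Path.walk R)) , R

    module _ (connected : Connected G) where

      DiamGE-between : Extendable a → Extendable b → DistGE G a b d → DiamGE G (4 + d)
      DiamGE-between {a} {b} a-ext b-ext a⇝b
        with k , P ← toPath (proj₂ (connected a b))
        with x , Q ← extend a-ext P
        with j , 2+k≤j , R ← reversePath Q
        with y , S ← extend b-ext R =
        y , x , λ W → ≤-trans (s≤s (s≤s 2+d≤j)) (Path⇒DistGE S W)
        where 2+d≤j = ≤-trans (s≤s (s≤s (a⇝b (Path.walk P)))) 2+k≤j

      DiamGE-6 : Extendable a → Extendable b → Extendable c → a ≢ b → b ≢ c → c ≢ a → DiamGE G 6
      DiamGE-6 {a} {b} {c} a-ext b-ext c-ext a≢b b≢c c≢a
        with adjacent? a b | adjacent? b c | adjacent? c a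
      ... | no ¬ab | _      | _      = DiamGE-between a-ext b-ext (nonadjacent⇒DistGE-2 a≢b ¬ab)
      ... | yes _  | no ¬bc | _      = DiamGE-between b-ext c-ext (nonadjacent⇒DistGE-2 b≢c ¬bc)
      ... | yes _  | yes _  | no ¬ca = DiamGE-between c-ext a-ext (nonadjacent⇒DistGE-2 c≢a ¬ca)
      ... | yes ab | yes bc | yes ca = ⊥-elim (acyclic (cycle [] triangle (ab ∷ bc ∷ ca ∷ [-])))
        where triangle = (a≢b ∷ ≢-sym c≢a ∷ []) ∷ (b≢c ∷ []) ∷ [] ∷ []

      diameter-bounds : ∀ {m} (vertex : Fin m → Fin n) → Injective _≡_ _≡_ vertex →
                        (∀ i → Extendable (vertex i)) →
                        (m ≡ 1 → DiamGE G 4) × (m ≡ 2 → DiamGE G 5) × (2 <ℕ m → DiamGE G 6)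
      diameter-bounds {0} _ _ _ = (λ ()) , (λ ()) , (λ ())
      diameter-bounds {1} _ _ ext =
        (λ _ → DiamGE-between (ext zero) (ext zero) (λ _ → z≤n)) , (λ ()) , λ { (s≤s ()) }
      diameter-bounds {2} _ injective ext =
        (λ ()) ,
        (λ _ → DiamGE-between (ext zero) (ext (suc zero)) (distinct⇒DistGE-1 (distinct λ ()))) ,
        λ { (s≤s (s≤s ())) }
        where distinct = injective⇒distinct injective
      diameter-bounds {suc (suc (suc _))} _ injective ext =
        (λ ()) , (λ ()) ,
        λ _ → DiamGE-6 (ext zero) (ext (suc zero)) (ext (suc (suc zero)))
                       (distinct λ ()) (distinct λ ()) (distinct λ ())
        where distinct = injective⇒distinct injective

module _ (G : SignedGraph) where
  open SignedGraph G

  signedSum : ∀ {m} → (Fin m → Maybe Sign) → ℤ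
  signedSum f = sumℤ G (tabulate (signVal G ∘ f))

  sdeg≡signedSum : ∀ v → sdeg G v ≡ signedSum (sgn v)
  sdeg≡signedSum v = cong (sumℤ G) (map-tabulate id (signVal G ∘ sgn v))

  positive-entry : ∀ {m} (f : Fin m → Maybe Sign) → + 1 ℤ.≤ signedSum f → ∃ λ i → f i ≡ just pos
  positive-entry {zero}  _ (ℤ.+≤+ ())
  positive-entry {suc m} f 1≤sum with f zero in eq
  ... | just pos = zero , eq
  ... | just neg = Product.map suc id (positive-entry (f ∘ suc) (ℤ.≤-trans 1≤sum (ℤ.i≤j⇒pred[i]≤j ℤ.≤-refl)))
  ... | nothing  = Product.map suc id (positive-entry (f ∘ suc) (subst (+ 1 ℤ.≤_) (ℤ.+-identityˡ _) 1≤sum))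

  negative-entry : ∀ {m} (f : Fin m → Maybe Sign) → signedSum f ℤ.≤ -[1+ 0 ] → ∃ λ i → f i ≡ just neg
  negative-entry {zero}  _ ()
  negative-entry {suc m} f sum≤-1 with f zero in eq
  ... | just neg = zero , eq
  ... | just pos = Product.map suc id (negative-entry (f ∘ suc) (ℤ.≤-trans (ℤ.i≤suc[i] _) sum≤-1))
  ... | nothing  = Product.map suc id (negative-entry (f ∘ suc) (subst (ℤ._≤ _) (ℤ.+-identityˡ _) sum≤-1))

  private
    shift : ∀ {m} (f : Fin (suc m) → Maybe Sign) →
            (∃₂ λ i j → i ≢ j × f (suc i) ≡ just neg × f (suc j) ≡ just neg) →
            ∃₂ λ i j → i ≢ j × f i ≡ just neg × f j ≡ just neg
    shift _ (i , j , i≢j , fi , fj) = suc i , suc j , i≢j ∘ suc-injective , fi , fj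

  two-negative-entries : ∀ {m} (f : Fin m → Maybe Sign) → signedSum f ℤ.≤ -[1+ 1 ] →
                         ∃₂ λ i j → i ≢ j × f i ≡ just neg × f j ≡ just neg
  two-negative-entries {zero}  _ ()
  two-negative-entries {suc m} f sum≤-2 with f zero in eq
  ... | just neg = zero , Product.map suc (λ fj → (λ ()) , eq , fj)
                                (negative-entry (f ∘ suc) (subst (ℤ._≤ _) (ℤ.suc-pred _) (ℤ.suc-mono sum≤-2)))
  ... | just pos = shift f (two-negative-entries (f ∘ suc) (ℤ.≤-trans (ℤ.i≤suc[i] _) sum≤-2))
  ... | nothing  = shift f (two-negative-entries (f ∘ suc) (subst (ℤ._≤ _) (ℤ.+-identityˡ _) sum≤-2))

  Sdeg1OrAtMost-2 : Set
  Sdeg1OrAtMost-2 = ∀ v → sdeg G v ≡ + 1 ⊎ sdeg G v ℤ.≤ -[1+ 1 ]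

  module _ (degrees : Sdeg1OrAtMost-2) where

    negative-neighbour-is-not-leaf : ∀ {v w} → sgn v w ≡ just neg → ∃ λ x → Edge G x w × x ≢ v
    negative-neighbour-is-not-leaf {v} {w} vw with degrees w
    ... | inj₁ w≡1
      with x , wx ← positive-entry (sgn w) (ℤ.≤-reflexive (trans (sym w≡1) (sdeg≡signedSum w))) =
      x , (pos , trans (symm x w) wx) , λ { refl → case trans (sym wx) (trans (symm w v) vw) of λ () }
    ... | inj₂ w≤-2
      with x₁ , x₂ , x₁≢x₂ , wx₁ , wx₂ ← two-negative-entries (sgn w) (subst (ℤ._≤ _) (sdeg≡signedSum w) w≤-2)
      with x , wx , x≢v ← avoiding x₁≢x₂ wx₁ wx₂ v =
      x , (neg , trans (symm x w) wx) , x≢v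

    extendable : ∀ {v} → sdeg G v ℤ.≤ -[1+ 1 ] → Extendable G v
    extendable {v} v≤-2 a
      with w₁ , w₂ , w₁≢w₂ , vw₁ , vw₂ ← two-negative-entries (sgn v) (subst (ℤ._≤ _) (sdeg≡signedSum v) v≤-2)
      with w , vw , w≢a ← avoiding w₁≢w₂ vw₁ vw₂ a
      with x , xw , x≢v ← negative-neighbour-is-not-leaf vw =
      w , x , xw , (neg , trans (symm w v) vw) , x≢v , w≢a

mainTheorem4 : (m : ℕ) → 1 ≤ m → (y : Fin m → ℤ) → Injective _≡_ _≡_ y →
    (∀ i → y i < - (+ 1)) →
    (T : SignedGraph) → IsTree T →
    Realizes T (λ x → (x ≡ + 1) ⊎ (∃ λ i → x ≡ y i)) →
    (m ≡ 1 → DiamGE T 4) × (m ≡ 2 → DiamGE T 5) × (2 <ℕ m → DiamGE T 6)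
mainTheorem4 m _ y y-injective y<-1 T (_ , connected , acyclic) (degrees , realized) =
  diameter-bounds T acyclic connected vertex vertex-injective
    (λ i → extendable T sdeg-1-or-≤-2 (subst (ℤ._≤ _) (sym (vertex-sdeg i)) (y≤-2 i)))
  where
  y≤-2 : ∀ i → y i ℤ.≤ -[1+ 1 ]
  y≤-2 i = ℤ.i<j⇒i≤pred[j] (y<-1 i)

  sdeg-1-or-≤-2 : Sdeg1OrAtMost-2 T
  sdeg-1-or-≤-2 v = map₂ (λ (i , sdeg≡yi) → subst (ℤ._≤ _) (sym sdeg≡yi) (y≤-2 i)) (degrees v)

  vertex : Fin m → Fin (SignedGraph.n T)
  vertex i = proj₁ (realized (y i) (inj₂ (i , refl)))

  vertex-sdeg : ∀ i → sdeg T (vertex i) ≡ y i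
  vertex-sdeg i = proj₂ (realized (y i) (inj₂ (i , refl)))

  vertex-injective : Injective _≡_ _≡_ vertex
  vertex-injective {i} {j} eq =
    y-injective (trans (sym (vertex-sdeg i)) (trans (cong (sdeg T) eq) (vertex-sdeg j)))
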